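{- Let $G=(A,B,E)$ be a balanced bipartite graph (so $|A|=|B|=n\geq 1$) and let $X$ be its reduced adjacency matrix (a square $(0,1)$-matrix of order $n$). Then $G$ is bistable if and only if $X$ is fully indecomposable.
   Context: All graphs are finite and simple. A stable set is a set of pairwise nonadjacent vertices; a maximum stable set is one of largest cardinality. A bipartite graph $G=(A,B,E)$ has bipartition $\{A,B\}$ and edge set $E$; it is balanced if $|A|=|B|$. It is called bistable if $A$ and $B$ are exactly the two maximum stable sets of $G$ (both are maximum stable sets and there are no others). If $A=\{a_1,\dots,a_m\}$ and $B=\{b_1,\dots,b_n\}$, the reduced adjacency matrix of $G$ is the $m\times n$ matrix $X=[x_{ij}]$ with $x_{ij}=1$ if $a_ib_j\in E$ and $x_{ij}=0$ otherwise. A square $(0,1)$-matrix of order $n$ is partly decomposable if either $n=1$ and its unique entry is $0$, or $n>1$ and for some integer $k$ with $1\leq k\leq n-1$ it has a $k\times(n-k)$ zero submatrix; it is fully indecomposable if it is not partly decomposable. (Full indecomposability does not depend on the ordering of $A$ and $B$.) -}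

module Defs where

open import Data.Nat using (ℕ; suc; _+_; _∸_; _≤_; _<_)
open import Data.Bool using (Bool; true; false)
open import Data.Fin using (Fin; zero)
open import Data.Fin.Subset using (Subset; _∈_; ∣_∣; ⊤; ⊥)
open import Data.Product using (_×_; Σ; ∃; ∃-syntax; _,_)
open import Data.Sum using (_⊎_)
open import Relation.Binary.PropositionalEquality using (_≡_)
open import Relation.Nullary using (¬_)

-- A square (0,1)-matrix of order n, entries as Bool (true = 1, false = 0).
Matrix01 : ℕ → Set
Matrix01 n = Fin n → Fin n → Bool

-- The balanced bipartite graph G = (A,B,E) with A = {a_0..a_{n-1}}, B = {b_0..b_{n-1}}
-- is represented by its reduced adjacency matrix X: a_i b_j ∈ E iff X i j ≡ true.
-- A vertex set of G is a pair (SA , SB) of subsets of A and B.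
VertexSet : ℕ → Set
VertexSet n = Subset n × Subset n

card : ∀ {n} → VertexSet n → ℕ
card (SA , SB) = ∣ SA ∣ + ∣ SB ∣

-- Stable: no two vertices of S adjacent. Only A–B pairs can be edges.
IsStable : ∀ {n} → Matrix01 n → VertexSet n → Set
IsStable X (SA , SB) = ∀ i j → i ∈ SA → j ∈ SB → X i j ≡ false

IsMaximumStable : ∀ {n} → Matrix01 n → VertexSet n → Set
IsMaximumStable X S = IsStable X S × (∀ T → IsStable X T → card T ≤ card S)

partA : ∀ {n} → VertexSet n
partA = ⊤ , ⊥

partB : ∀ {n} → VertexSet n
partB = ⊥ , ⊤

Bistable : ∀ {n} → Matrix01 n → Set
Bistable X = IsMaximumStable X partA × IsMaximumStable X partB
           × (∀ S → IsMaximumStable X S → S ≡ partA ⊎ S ≡ partB)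

HasZeroSubmatrix : ∀ {n} → Matrix01 n → ℕ → ℕ → Set
HasZeroSubmatrix {n} X k m =
  Σ (Subset n) λ R → Σ (Subset n) λ C →
    (∣ R ∣ ≡ k) × (∣ C ∣ ≡ m) × (∀ i j → i ∈ R → j ∈ C → X i j ≡ false)

PartlyDecomposable : ∀ {n} → Matrix01 n → Set
PartlyDecomposable {n} X =
    (n ≡ 1 × Σ (Fin n) λ i → X i i ≡ false)
  ⊎ (1 < n × ∃[ k ] (1 ≤ k × k ≤ n ∸ 1 × HasZeroSubmatrix X k (n ∸ k)))

FullyIndecomposable : ∀ {n} → Matrix01 n → Set
FullyIndecomposable X = ¬ PartlyDecomposable X

-- A stable set (R , C) of G that meets both A and B is, read on X, the zero
-- submatrix with rows R and columns C. Since A and B are stable sets of size n,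
-- G is bistable exactly when every stable set meeting both sides has fewer than
-- n vertices, i.e. when X has no k × (n − k) zero submatrix with 1 ≤ k ≤ n − 1
-- (for n = 1: no zero entry, as then {a₁ , b₁} itself is stable).
module Submission where

open import Defs
open import Data.Nat using (ℕ; zero; suc; _+_; _∸_; _⊓_; _≤_; _<_; z≤n; s≤s; _≤?_)
open import Data.Nat.Properties
  using (≤-antisym; ≤-trans; <⇒≤; ≰⇒>; <⇒≱; +-identityʳ; m⊓n≤m; m⊓n≤n; ⊓-glb; ⊔-lub;
         ∸-distribˡ-⊓-⊔; m≤n+o⇒m∸n≤o; m+[n∸m]≡n; m+n∸n≡m; m<n⇒0<n∸m; ≤-reflexive)
import Data.Fin as Fin
open import Data.Fin.Subset using (Subset; _⊆_; ∣_∣; ⊤; ⊥; Nonempty; outside; inside)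
open import Data.Fin.Subset.Properties
  using (∉⊥; ∈⊤; ⊥⊆; ∣⊥∣≡0; ∣⊤∣≡n; ∣p∣≡n⇒p≡⊤; ∣p∣≤n; Empty-unique; nonempty?; s⊆s; in⊆in;
         x∈p⇒∣p-x∣<∣p∣)
open import Data.Vec using ([]; _∷_)
open import Data.Product using (_×_; Σ; ∃₂; _,_)
open import Data.Sum using (_⊎_; inj₁; inj₂)
open import Data.Empty using (⊥-elim)
open import Function.Bundles using (_⇔_; mk⇔)
open import Relation.Binary.PropositionalEquality using (_≡_; refl; sym; trans; cong; cong₂; subst)
open import Relation.Nullary using (¬_; yes; no)

private
  variable
    n : ℕ

subset-ofSize : ∀ (p : Subset n) j → j ≤ ∣ p ∣ → Σ (Subset n) λ q → q ⊆ p × ∣ q ∣ ≡ j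
subset-ofSize [] zero _ = [] , (λ x∈ → x∈) , refl
subset-ofSize (outside ∷ p) j j≤ with subset-ofSize p j j≤
... | q , q⊆p , ∣q∣≡j = outside ∷ q , s⊆s q⊆p , ∣q∣≡j
subset-ofSize {suc n} (inside ∷ p) zero _ = ⊥ , ⊥⊆ , ∣⊥∣≡0 (suc n)
subset-ofSize (inside ∷ p) (suc j) (s≤s j≤) with subset-ofSize p j j≤
... | q , q⊆p , ∣q∣≡j = inside ∷ q , in⊆in q⊆p , cong suc ∣q∣≡j

nonempty⇒∣p∣≥1 : {p : Subset n} → Nonempty p → 1 ≤ ∣ p ∣
nonempty⇒∣p∣≥1 (_ , x∈p) = ≤-trans (s≤s z≤n) (x∈p⇒∣p-x∣<∣p∣ x∈p)

∣⊥∣≱1 : ¬ (1 ≤ ∣ ⊥ {n} ∣)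
∣⊥∣≱1 {n} 1≤∣⊥∣ with subst (1 ≤_) (∣⊥∣≡0 n) 1≤∣⊥∣
... | ()

card-⊥ˡ : (SB : Subset n) → card (⊥ , SB) ≡ ∣ SB ∣
card-⊥ˡ {n} SB = cong (_+ ∣ SB ∣) (∣⊥∣≡0 n)

card-⊥ʳ : (SA : Subset n) → card (SA , ⊥) ≡ ∣ SA ∣
card-⊥ʳ {n} SA = trans (cong (∣ SA ∣ +_) (∣⊥∣≡0 n)) (+-identityʳ ∣ SA ∣)

card-partA : card (partA {n}) ≡ n
card-partA {n} = trans (card-⊥ʳ (⊤ {n})) (∣⊤∣≡n n)

card-partB : card (partB {n}) ≡ n
card-partB {n} = trans (card-⊥ˡ (⊤ {n})) (∣⊤∣≡n n)

∣p∣≥n⇒p≡⊤ : {p : Subset n} → n ≤ ∣ p ∣ → p ≡ ⊤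
∣p∣≥n⇒p≡⊤ {p = p} n≤∣p∣ = ∣p∣≡n⇒p≡⊤ (≤-antisym (∣p∣≤n p) n≤∣p∣)

partA-stable : (X : Matrix01 n) → IsStable X partA
partA-stable X _ _ _ j∈⊥ = ⊥-elim (∉⊥ j∈⊥)

partB-stable : (X : Matrix01 n) → IsStable X partB
partB-stable X _ _ i∈⊥ _ = ⊥-elim (∉⊥ i∈⊥)

stable-⊆ : {X : Matrix01 n} {SA SB RA RB : Subset n} →
           RA ⊆ SA → RB ⊆ SB → IsStable X (SA , SB) → IsStable X (RA , RB)
stable-⊆ RA⊆SA RB⊆SB stable i j i∈RA j∈RB = stable i j (RA⊆SA i∈RA) (RB⊆SB j∈RB)

stable⇒zeroSubmatrix : {X : Matrix01 n} {SA SB : Subset n} {k m : ℕ} →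
                       IsStable X (SA , SB) → k ≤ ∣ SA ∣ → m ≤ ∣ SB ∣ → HasZeroSubmatrix X k m
stable⇒zeroSubmatrix {SA = SA} {SB} {k} {m} stable k≤ m≤
  with subset-ofSize SA k k≤ | subset-ofSize SB m m≤
... | R , R⊆SA , ∣R∣≡k | C , C⊆SB , ∣C∣≡m = R , C , ∣R∣≡k , ∣C∣≡m , stable-⊆ R⊆SA C⊆SB stable

IsLargeMixedStable : Matrix01 n → Subset n → Subset n → Set
IsLargeMixedStable {n} X SA SB =
  IsStable X (SA , SB) × 1 ≤ ∣ SA ∣ × 1 ≤ ∣ SB ∣ × n ≤ ∣ SA ∣ + ∣ SB ∣

largeMixedStable⇒partlyDecomposable : {X : Matrix01 n} {SA SB : Subset n} →
  IsLargeMixedStable X SA SB → PartlyDecomposable X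
largeMixedStable⇒partlyDecomposable {zero} {SA = SA} (_ , 1≤∣SA∣ , _) with ≤-trans 1≤∣SA∣ (∣p∣≤n SA)
... | ()
largeMixedStable⇒partlyDecomposable {suc zero} {SA = inside ∷ []} {inside ∷ []} (stable , _) =
  inj₁ (refl , Fin.zero , stable Fin.zero Fin.zero (∈⊤ {x = Fin.zero}) (∈⊤ {x = Fin.zero}))
largeMixedStable⇒partlyDecomposable {suc (suc m)} {SA = SA} {SB} (stable , 1≤∣SA∣ , 1≤∣SB∣ , n≤card) =
  inj₂ (s≤s (s≤s z≤n) , k , ⊓-glb 1≤∣SA∣ (s≤s z≤n) , m⊓n≤n ∣ SA ∣ (suc m) ,
        stable⇒zeroSubmatrix stable (m⊓n≤m ∣ SA ∣ (suc m)) n∸k≤∣SB∣)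
  where
  -- Capping the row count at n − 1 keeps n − k ≤ ∣ SB ∣, since ∣ SB ∣ ≥ 1.
  k = ∣ SA ∣ ⊓ suc m
  n∸k≤∣SB∣ : suc (suc m) ∸ k ≤ ∣ SB ∣
  n∸k≤∣SB∣ = subst (_≤ ∣ SB ∣) (sym (∸-distribˡ-⊓-⊔ (suc (suc m)) ∣ SA ∣ (suc m)))
    (⊔-lub (m≤n+o⇒m∸n≤o (suc (suc m)) ∣ SA ∣ n≤card)
           (subst (_≤ ∣ SB ∣) (sym (m+n∸n≡m 1 (suc m))) 1≤∣SB∣))

partlyDecomposable⇒largeMixedStable : {X : Matrix01 n} →
  PartlyDecomposable X → ∃₂ (IsLargeMixedStable X)
partlyDecomposable⇒largeMixedStable {X = X} (inj₁ (refl , Fin.zero , Xii≡0)) =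
  ⊤ , ⊤ , stable , s≤s z≤n , s≤s z≤n , s≤s z≤n
  where
  stable : IsStable X (⊤ , ⊤)
  stable Fin.zero Fin.zero _ _ = Xii≡0
partlyDecomposable⇒largeMixedStable {n}
  (inj₂ (s≤s (s≤s _) , k , 1≤k , k≤n-1 , R , C , ∣R∣≡k , ∣C∣≡n-k , R×C-zero)) =
  R , C , R×C-zero ,
  subst (1 ≤_) (sym ∣R∣≡k) 1≤k ,
  subst (1 ≤_) (sym ∣C∣≡n-k) (m<n⇒0<n∸m (s≤s k≤n-1)) ,
  subst (n ≤_) (cong₂ _+_ (sym ∣R∣≡k) (sym ∣C∣≡n-k)) (≤-reflexive (sym (m+[n∸m]≡n (<⇒≤ (s≤s k≤n-1)))))

stable-≥maximum⇒maximum : {X : Matrix01 n} {S T : VertexSet n} →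
  IsMaximumStable X S → IsStable X T → card S ≤ card T → IsMaximumStable X T
stable-≥maximum⇒maximum (_ , S-max) T-stable S≤T =
  T-stable , λ U U-stable → ≤-trans (S-max U U-stable) S≤T

bistable⇒fullyIndecomposable : {X : Matrix01 n} → Bistable X → FullyIndecomposable X
bistable⇒fullyIndecomposable {n} (A-max , _ , onlyAB) pd
  with partlyDecomposable⇒largeMixedStable pd
... | SA , SB , stable , 1≤∣SA∣ , 1≤∣SB∣ , n≤card
  with onlyAB (SA , SB)
         (stable-≥maximum⇒maximum A-max stable (subst (_≤ ∣ SA ∣ + ∣ SB ∣) (sym card-partA) n≤card))
... | inj₁ refl = ∣⊥∣≱1 {n} 1≤∣SB∣
... | inj₂ refl = ∣⊥∣≱1 {n} 1≤∣SA∣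

module _ {X : Matrix01 n} (fullyIndecomposable : FullyIndecomposable X) where

  stable-oneSided⊎small : {SA SB : Subset n} → IsStable X (SA , SB) →
                          SA ≡ ⊥ ⊎ SB ≡ ⊥ ⊎ ∣ SA ∣ + ∣ SB ∣ < n
  stable-oneSided⊎small {SA} {SB} stable with nonempty? SA | nonempty? SB
  ... | no SA-empty | _ = inj₁ (Empty-unique SA-empty)
  ... | yes _ | no SB-empty = inj₂ (inj₁ (Empty-unique SB-empty))
  ... | yes SA-nonempty | yes SB-nonempty with n ≤? ∣ SA ∣ + ∣ SB ∣
  ...   | no n≰card = inj₂ (inj₂ (≰⇒> n≰card))
  ...   | yes n≤card = ⊥-elim (fullyIndecomposable (largeMixedStable⇒partlyDecomposable
            (stable , nonempty⇒∣p∣≥1 SA-nonempty , nonempty⇒∣p∣≥1 SB-nonempty , n≤card)))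

  stable-card≤n : (S : VertexSet n) → IsStable X S → card S ≤ n
  stable-card≤n (SA , SB) stable with stable-oneSided⊎small stable
  ... | inj₁ refl = subst (_≤ n) (sym (card-⊥ˡ SB)) (∣p∣≤n SB)
  ... | inj₂ (inj₁ refl) = subst (_≤ n) (sym (card-⊥ʳ SA)) (∣p∣≤n SA)
  ... | inj₂ (inj₂ card<n) = <⇒≤ card<n

  maximumStable-onlyAB : (S : VertexSet n) → IsMaximumStable X S → S ≡ partA ⊎ S ≡ partB
  maximumStable-onlyAB (SA , SB) (stable , S-max)
    with subst (_≤ card (SA , SB)) card-partA (S-max partA (partA-stable X))
       | stable-oneSided⊎small stable
  ... | n≤card | inj₁ refl = inj₂ (cong (⊥ ,_) (∣p∣≥n⇒p≡⊤ (subst (n ≤_) (card-⊥ˡ SB) n≤card)))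
  ... | n≤card | inj₂ (inj₁ refl) = inj₁ (cong (_, ⊥) (∣p∣≥n⇒p≡⊤ (subst (n ≤_) (card-⊥ʳ SA) n≤card)))
  ... | n≤card | inj₂ (inj₂ card<n) = ⊥-elim (<⇒≱ card<n n≤card)

  fullyIndecomposable⇒bistable : Bistable X
  fullyIndecomposable⇒bistable =
    (partA-stable X , λ T T-stable → subst (card T ≤_) (sym (card-partA {n})) (stable-card≤n T T-stable)) ,
    (partB-stable X , λ T T-stable → subst (card T ≤_) (sym (card-partB {n})) (stable-card≤n T T-stable)) ,
    maximumStable-onlyAB

proposition5 : (n : ℕ) → 1 ≤ n → (X : Matrix01 n) →
               Bistable X ⇔ FullyIndecomposable X
proposition5 n _ X = mk⇔ bistable⇒fullyIndecomposable fullyIndecomposable⇒bistable
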